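{- Let $k\geq 4$. Then $\operatorname{Av}_n(B_k)=\{\operatorname{id}_n,\operatorname{id}_n^r\}$ for all $n\geq (2k-5)^2+1$. Equivalently, $N_k\leq (2k-5)^2+1$.
   Context: $\operatorname{id}_n=12\cdots n$, $\operatorname{id}_n^r=n\cdots21$; $\pi^c$ is the complement. $\operatorname{Av}_n(X)$ is the set of permutations in $S_n$ avoiding (classically) every pattern in $X$. For $k\ge3$, $p_k=12\cdots(k-2)\,k\,(k-1)$, $q_k=1\,k\,(k-1)\cdots 2$, $r_k=2\,1\,3\,4\cdots k$, $s_k=2\,3\cdots k\,1$, and $B_k=\{p_k,q_k,r_k,s_k,p_k^c,q_k^c,r_k^c,s_k^c\}$. $N_k$ is the least integer such that $\operatorname{Av}_n(B_k)=\{\operatorname{id}_n,\operatorname{id}_n^r\}$ for all $n\geq N_k$. -}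

module Defs where

open import Data.Nat using (ℕ; zero; suc; _+_; _∸_; _<ᵇ_; _≡ᵇ_)
open import Data.Bool using (if_then_else_)
open import Data.Fin using (Fin; toℕ; opposite)
import Data.Fin as F
open import Data.Product using (Σ; ∃; _×_; _,_; proj₁; proj₂)
open import Data.List using (List; []; _∷_)
open import Data.List.Relation.Unary.All using (All)
open import Function.Definitions using (Injective)
open import Function.Bundles using (_⇔_)
open import Relation.Binary.PropositionalEquality using (_≡_)
open import Relation.Nullary using (¬_)
import Data.Nat as N

Perm : ℕ → Set
Perm n = Σ (Fin n → Fin n) (Injective _≡_ _≡_)

-- A pattern of length k in one-line notation, values in {0,…,k-1}
-- (0-indexed, i.e. the paper's values minus one).
Pattern : ℕ → Set
Pattern k = Fin k → ℕ

Contains : ∀ {n k} → Perm n → Pattern k → Set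
Contains {n} {k} (π , _) σ =
  ∃ λ (e : Fin k → Fin n) →
    (∀ a b → a F.< b → e a F.< e b) ×
    (∀ a b → (σ a N.< σ b) ⇔ (π (e a) F.< π (e b)))

Avoids : ∀ {n} → Perm n → (List (Σ ℕ Pattern)) → Set
Avoids π X = All (λ p → ¬ Contains π (proj₂ p)) X

comp : ∀ {k} → Pattern k → Pattern k
comp {k} σ j = (k ∸ 1) ∸ σ j

-- p_k = 1 2 … (k-2) k (k-1)
p : (k : ℕ) → Pattern k
p k j = if toℕ j <ᵇ (k ∸ 2) then toℕ j
        else (if toℕ j ≡ᵇ (k ∸ 2) then k ∸ 1 else k ∸ 2)

-- q_k = 1 k (k-1) … 2
q : (k : ℕ) → Pattern k
q k j = if toℕ j ≡ᵇ 0 then 0 else k ∸ toℕ j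

-- r_k = 2 1 3 4 … k
r : (k : ℕ) → Pattern k
r k j = if toℕ j ≡ᵇ 0 then 1 else (if toℕ j ≡ᵇ 1 then 0 else toℕ j)

-- s_k = 2 3 … k 1
s : (k : ℕ) → Pattern k
s k j = if toℕ j ≡ᵇ (k ∸ 1) then 0 else suc (toℕ j)

B : (k : ℕ) → List (Σ ℕ Pattern)
B k = (k , p k) ∷ (k , q k) ∷ (k , r k) ∷ (k , s k)
    ∷ (k , comp (p k)) ∷ (k , comp (q k)) ∷ (k , comp (r k)) ∷ (k , comp (s k)) ∷ []

IsId : ∀ {n} → Perm n → Set
IsId {n} π = ∀ i → proj₁ π i ≡ i

IsRev : ∀ {n} → Perm n → Set
IsRev {n} π = ∀ i → proj₁ π i ≡ opposite i

-- Write m = k - 2.  If π avoids B_k but is neither id_n nor its reverse, then π and its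
-- complement both have an inversion; as B_k is closed under complement, Erdős–Szekeres with
-- n > (2m-1)² lets us assume that π has an increasing subsequence of length 2m.  Since also
-- n > (3m-2)m, π has an increasing subsequence of length 3m-1 or a decreasing one of length
-- m+1.  In the first case s and qᶜ confine the entries outside the middle third of the long
-- subsequence, and then p and r leave no room for an inversion; in the second case the two
-- monotone subsequences are forced into one of p, q, r, s, qᶜ, sᶜ.  Conversely, id_n and its
-- reverse avoid every pattern with both an ascent and a descent, as all eight patterns are.
module Submission where

open import Defs
open import Data.Bool.Base using (true; false; if_then_else_; T)
open import Data.Empty using (⊥; ⊥-elim)
open import Data.Fin as F using (Fin; toℕ; fromℕ<; opposite; #_)
import Data.Fin.Properties as FP
open import Data.List.Relation.Unary.All using ([]; _∷_)
open import Data.Nat.Base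
  using (ℕ; zero; suc; _+_; _*_; _∸_; _^_; _≤_; _<_; z≤n; s≤s; s≤s⁻¹; _<ᵇ_; _≡ᵇ_)
open import Data.Nat.Properties
open import Data.Nat.Tactic.RingSolver using (solve-∀)
open import Data.Product.Base using (∃; ∃₂; _×_; _,_; proj₁; proj₂)
open import Data.Sum.Base using (_⊎_; inj₁; inj₂; [_,_]; fromInj₁; fromInj₂)
open import Data.Vec.Functional using (updateAt)
open import Data.Vec.Functional.Properties using (updateAt-updates; updateAt-minimal)
open import Function.Base using (_∘_; flip)
open import Function.Bundles using (_⇔_; mk⇔; Equivalence)
import Function.Properties.Equivalence as ⇔
open import Relation.Binary.Definitions using (Transitive; tri<; tri≈; tri>)
open import Relation.Binary.PropositionalEquality using (_≡_; _≢_; refl; sym; trans; cong; subst; subst₂)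
open import Relation.Nullary using (¬_; Dec; yes; no)
open import Relation.Nullary.Decidable using (_×-dec_)

open Equivalence using (to; from)

<ᵇ-true : ∀ {x y} → x < y → (x <ᵇ y) ≡ true
<ᵇ-true {x} {y} x<y with x <ᵇ y in eq
... | true  = refl
... | false = ⊥-elim (subst T eq (<⇒<ᵇ x<y))

<ᵇ-false : ∀ {x y} → y ≤ x → (x <ᵇ y) ≡ false
<ᵇ-false {x} {y} y≤x with x <ᵇ y in eq
... | false = refl
... | true  = ⊥-elim (<⇒≱ (<ᵇ⇒< x y (subst T (sym eq) _)) y≤x)

≡ᵇ-refl : ∀ x → (x ≡ᵇ x) ≡ true
≡ᵇ-refl zero    = refl
≡ᵇ-refl (suc x) = ≡ᵇ-refl x

≡ᵇ-false : ∀ {x y} → x ≢ y → (x ≡ᵇ y) ≡ false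
≡ᵇ-false {x} {y} x≢y with x ≡ᵇ y in eq
... | false = refl
... | true  = ⊥-elim (x≢y (≡ᵇ⇒≡ x y (subst T (sym eq) _)))

<ᵇ-irrefl : ∀ m → (m <ᵇ m) ≡ false
<ᵇ-irrefl m = <ᵇ-false (≤-refl {m})

1+m<ᵇm : ∀ m → (suc m <ᵇ m) ≡ false
1+m<ᵇm m = <ᵇ-false (n≤1+n m)

1+m≡ᵇm : ∀ m → (suc m ≡ᵇ m) ≡ false
1+m≡ᵇm m = ≡ᵇ-false (1+n≢n {m})

data Below-At-Next (m : ℕ) : ℕ → Set where
  below : ∀ {x} → x < m → Below-At-Next m x
  at    : Below-At-Next m m
  next  : Below-At-Next m (suc m)

below-at-next : ∀ {m x} → x < suc (suc m) → Below-At-Next m x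
below-at-next {m} {x} x<2+m with <-cmp x m
... | tri< x<m _ _ = below x<m
... | tri≈ _ refl _ = at
... | tri> _ _ m<x with ≤-antisym (s≤s⁻¹ x<2+m) m<x
...   | refl = next

below-or-last : ∀ {m x} → x < suc m → x < m ⊎ x ≡ m
below-or-last x<1+m = m≤n⇒m<n∨m≡n (s≤s⁻¹ x<1+m)

-- Chains of entries

value : ∀ {n} → Perm n → Fin n → ℕ
value π i = toℕ (proj₁ π i)

module _ {n} (π : Perm n) where

  value-injective : ∀ {i j} → value π i ≡ value π j → i ≡ j
  value-injective eq = proj₂ π (FP.toℕ-injective eq)

  value-cmp : ∀ {i j} → i F.< j → value π i < value π j ⊎ value π j < value π i
  value-cmp {i} {j} i<j with <-cmp (value π i) (value π j)
  ... | tri< lt _ _ = inj₁ lt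
  ... | tri≈ _ eq _ = ⊥-elim (<-irrefl (cong toℕ (value-injective eq)) i<j)
  ... | tri> _ _ gt = inj₂ gt

  position-cmp : ∀ {i j} → value π i < value π j → i F.< j ⊎ j F.< i
  position-cmp {i} {j} lt with <-cmp (toℕ i) (toℕ j)
  ... | tri< i<j _ _ = inj₁ i<j
  ... | tri≈ _ eq _ = ⊥-elim (<-irrefl (cong (value π) (FP.toℕ-injective eq)) lt)
  ... | tri> _ _ j<i = inj₂ j<i

adjacent⇒ordered : ∀ {A : Set} (_≺_ : A → A → Set) → Transitive _≺_ →
                   ∀ {L} (g : ℕ → A) → (∀ u → suc u < L → g u ≺ g (suc u)) →
                   ∀ {x y} → x < y → y < L → g x ≺ g y
adjacent⇒ordered _≺_ trans g step {x} {suc y} x<1+y 1+y<L with below-or-last x<1+y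
... | inj₁ x<y  = trans (adjacent⇒ordered _≺_ trans g step x<y (<-trans (n<1+n y) 1+y<L)) (step y 1+y<L)
... | inj₂ refl = step y 1+y<L

record Chain {n} (R : Fin n → Fin n → Set) (L : ℕ) (c : ℕ → Fin n) : Set where
  constructor chain
  field step : ∀ x → suc x < L → c x F.< c (suc x) × R (c x) (c (suc x))
open Chain public

Ascending Descending : ∀ {n} → Perm n → ℕ → (ℕ → Fin n) → Set
Ascending π  = Chain (λ i j → value π i < value π j)
Descending π = Chain (λ i j → value π j < value π i)

module _ {n} {R : Fin n → Fin n → Set} {L} {c : ℕ → Fin n} (ch : Chain R L c) where

  chain-positions : ∀ {x y} → x < y → y < L → c x F.< c y
  chain-positions = adjacent⇒ordered F._<_ FP.<-trans c (λ u l → proj₁ (step ch u l))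

  chain-related : Transitive R → ∀ {x y} → x < y → y < L → R (c x) (c y)
  chain-related trans = adjacent⇒ordered R trans c (λ u l → proj₂ (step ch u l))

  chain-prefix : ∀ {L′} → L′ ≤ L → Chain R L′ c
  chain-prefix L′≤L = chain λ x l → step ch x (<-≤-trans l L′≤L)

chain-suffix : ∀ {n R L c} o → Chain {n} R (L + o) c → Chain R L (λ x → c (x + o))
chain-suffix o ch = chain λ x l → step ch (x + o) (+-monoˡ-< o l)

ascending-values : ∀ {n} (π : Perm n) {L c} → Ascending π L c →
                   ∀ {x y} → x < y → y < L → value π (c x) < value π (c y)
ascending-values π asc = chain-related asc <-trans

descending-values : ∀ {n} (π : Perm n) {L c} → Descending π L c →
                    ∀ {x y} → x < y → y < L → value π (c y) < value π (c x)
descending-values π desc = chain-related desc (flip <-trans)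

-- Complements

module _ (m : ℕ) where
  private
    k : ℕ
    k = suc (suc m)

  p-range : ∀ j → p k j < k
  p-range j with toℕ j | FP.toℕ<n j
  ... | x | x<k with below-at-next x<k
  ...   | below x<m rewrite <ᵇ-true x<m = x<k
  ...   | at   rewrite <ᵇ-irrefl m | ≡ᵇ-refl m = ≤-refl
  ...   | next rewrite 1+m<ᵇm m | 1+m≡ᵇm m = m<n⇒m<1+n (n<1+n m)

  q-range : ∀ j → q k j < k
  q-range j with toℕ j
  ... | zero  = s≤s z≤n
  ... | suc x = s≤s (m∸n≤m (suc m) x)

  r-range : ∀ j → r k j < k
  r-range j with toℕ j | FP.toℕ<n j
  ... | zero          | _   = s≤s (s≤s z≤n)
  ... | suc zero      | _   = s≤s z≤n
  ... | suc (suc x)   | x<k = x<k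

  s-range : ∀ j → s k j < k
  s-range j with toℕ j | FP.toℕ<n j
  ... | x | x<k with below-or-last x<k
  ...   | inj₁ x<1+m rewrite ≡ᵇ-false (<⇒≢ x<1+m) = s≤s x<1+m
  ...   | inj₂ refl  rewrite ≡ᵇ-refl (suc m) = s≤s z≤n

comp-range : ∀ {k} (σ : Pattern k) j → comp σ j < k
comp-range {suc k} σ j = s≤s (m∸n≤m k (σ j))

-- comp truncates at 0, so it reverses the order only of patterns with values below k.
comp-reverses : ∀ {k} {σ : Pattern k} → (∀ j → σ j < k) → ∀ a b → (comp σ a < comp σ b) ⇔ (σ b < σ a)
comp-reverses {suc k} range a b = mk⇔ ∸-cancelʳ-< (λ lt → ∸-monoʳ-< lt (s≤s⁻¹ (range a)))

opposite-< : ∀ {n} {i j : Fin n} → i F.< j → opposite j F.< opposite i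
opposite-< {n} {i} {j} i<j rewrite FP.opposite-prop i | FP.opposite-prop j =
  ∸-monoʳ-< (s≤s i<j) (FP.toℕ<n j)

opposite-<⁻¹ : ∀ {n} {i j : Fin n} → opposite i F.< opposite j → j F.< i
opposite-<⁻¹ {i = i} {j} lt =
  subst₂ F._<_ (FP.opposite-involutive j) (FP.opposite-involutive i) (opposite-< lt)

opposite-injective : ∀ {n} {i j : Fin n} → opposite i ≡ opposite j → i ≡ j
opposite-injective {i = i} {j} eq =
  trans (sym (FP.opposite-involutive i)) (trans (cong opposite eq) (FP.opposite-involutive j))

complement : ∀ {n} → Perm n → Perm n
complement π = (λ i → opposite (proj₁ π i)) , λ eq → proj₂ π (opposite-injective eq)

descending⇒ascending-complement : ∀ {n} (π : Perm n) {L c} → Descending π L c →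
                                  Ascending (complement π) L c
descending⇒ascending-complement π desc =
  chain λ x l → proj₁ (step desc x l) , opposite-< (proj₂ (step desc x l))

complement-contains⇒contains-reversed : ∀ {n k} (π : Perm n) {σ τ : Pattern k} →
                                        (∀ a b → (σ a < σ b) ⇔ (τ b < τ a)) →
                                        Contains (complement π) σ → Contains π τ
complement-contains⇒contains-reversed π σ⇔τ (e , e-increasing , order) = e , e-increasing , λ a b → mk⇔
  (λ τa<τb → opposite-<⁻¹ (to (order b a) (from (σ⇔τ b a) τa<τb)))
  (λ πa<πb → to (σ⇔τ b a) (from (order b a) (opposite-< πa<πb)))

module _ {n k} (π : Perm n) {τ : Pattern k} (range : ∀ j → τ j < k) where

  complement-contains-comp⇒contains : Contains (complement π) (comp τ) → Contains π τ
  complement-contains-comp⇒contains = complement-contains⇒contains-reversed π (comp-reverses range)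

  complement-contains⇒contains-comp : Contains (complement π) τ → Contains π (comp τ)
  complement-contains⇒contains-comp = complement-contains⇒contains-reversed π λ a b →
    ⇔.sym (comp-reverses range b a)

avoids-B-complement : ∀ {n} m (π : Perm n) → Avoids π (B (2 + m)) → Avoids (complement π) (B (2 + m))
avoids-B-complement m π (¬p ∷ ¬q ∷ ¬r ∷ ¬s ∷ ¬pᶜ ∷ ¬qᶜ ∷ ¬rᶜ ∷ ¬sᶜ ∷ []) =
    ¬pᶜ ∘ complement-contains⇒contains-comp π (p-range m)
  ∷ ¬qᶜ ∘ complement-contains⇒contains-comp π (q-range m)
  ∷ ¬rᶜ ∘ complement-contains⇒contains-comp π (r-range m)
  ∷ ¬sᶜ ∘ complement-contains⇒contains-comp π (s-range m)
  ∷ ¬p ∘ complement-contains-comp⇒contains π (p-range m)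
  ∷ ¬q ∘ complement-contains-comp⇒contains π (q-range m)
  ∷ ¬r ∘ complement-contains-comp⇒contains π (r-range m)
  ∷ ¬s ∘ complement-contains-comp⇒contains π (s-range m)
  ∷ []

-- Occurrences of the patterns

-- E lists the entries of an occurrence from left to right, F lists them from
-- bottom to top, and S sends the position of an entry to its rank.
contains-by-rank : ∀ {n} (π : Perm n) k (S : ℕ → ℕ) (E F : ℕ → Fin n) →
                   (∀ (j : Fin k) → S (toℕ j) < k) → (∀ x → x < k → E x ≡ F (S x)) →
                   (∀ x → suc x < k → E x F.< E (suc x)) →
                   (∀ u → suc u < k → value π (F u) < value π (F (suc u))) →
                   Contains π (λ j → S (toℕ j))
contains-by-rank π k S E F S<k E≡F∘S E-steps F-steps = e , e-increasing , rank-order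
  where
  e : Fin k → Fin _
  e j = E (toℕ j)

  e-increasing : ∀ a b → a F.< b → e a F.< e b
  e-increasing a b a<b = adjacent⇒ordered F._<_ FP.<-trans E E-steps a<b (FP.toℕ<n b)

  value-e : ∀ a → value π (e a) ≡ value π (F (S (toℕ a)))
  value-e a = cong (value π) (E≡F∘S (toℕ a) (FP.toℕ<n a))

  rank<⇒value< : ∀ a b → S (toℕ a) < S (toℕ b) → value π (e a) < value π (e b)
  rank<⇒value< a b lt rewrite value-e a | value-e b =
    adjacent⇒ordered _<_ <-trans (λ u → value π (F u)) F-steps lt (S<k b)

  value<⇒rank< : ∀ a b → value π (e a) < value π (e b) → S (toℕ a) < S (toℕ b)
  value<⇒rank< a b lt with <-cmp (S (toℕ a)) (S (toℕ b))
  ... | tri< a<b _ _ = a<b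
  ... | tri≈ _ eq _ = ⊥-elim (<-irrefl (trans (value-e a) (trans (cong (value π ∘ F) eq) (sym (value-e b))))
                                        lt)
  ... | tri> _ _ b<a = ⊥-elim (<-asym lt (rank<⇒value< b a b<a))

  rank-order : ∀ a b → (S (toℕ a) < S (toℕ b)) ⇔ (value π (e a) < value π (e b))
  rank-order a b = mk⇔ (rank<⇒value< a b) (value<⇒rank< a b)

module Occurrences {n} (π : Perm n) (m₁ : ℕ) where
  private
    m : ℕ
    m = suc m₁
    k : ℕ
    k = suc (suc m)

  p-occurrence : ∀ {c X Y} → Ascending π m c → c m₁ F.< X → X F.< Y →
                 value π (c m₁) < value π Y → value π Y < value π X → Contains π (p k)
  p-occurrence {c} {X} {Y} asc c<X X<Y c<ᵥY Y<ᵥX =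
    contains-by-rank π k S E F (p-range m) E≡F∘S E-steps F-steps
    where
    S : ℕ → ℕ
    S x = if x <ᵇ m then x else (if x ≡ᵇ m then suc m else m)
    E F : ℕ → Fin n
    E x = if x <ᵇ m then c x else (if x ≡ᵇ m then X else Y)
    F u = if u <ᵇ m then c u else (if u ≡ᵇ m then Y else X)

    E≡F∘S : ∀ x → x < k → E x ≡ F (S x)
    E≡F∘S x x<k with below-at-next x<k
    ... | below x<m rewrite <ᵇ-true x<m | <ᵇ-true x<m = refl  -- the second rewrite evaluates F x
    ... | at   rewrite <ᵇ-irrefl m | ≡ᵇ-refl m | 1+m<ᵇm m | 1+m≡ᵇm m = refl
    ... | next rewrite 1+m<ᵇm m | 1+m≡ᵇm m | <ᵇ-irrefl m | ≡ᵇ-refl m = refl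

    E-steps : ∀ x → suc x < k → E x F.< E (suc x)
    E-steps x 1+x<k with below-at-next 1+x<k
    ... | below 1+x<m rewrite <ᵇ-true (<-trans (n<1+n x) 1+x<m) | <ᵇ-true 1+x<m =
      proj₁ (step asc x 1+x<m)
    ... | at   rewrite <ᵇ-true (n<1+n m₁) | <ᵇ-irrefl m | ≡ᵇ-refl m = c<X
    ... | next rewrite <ᵇ-irrefl m | ≡ᵇ-refl m | 1+m<ᵇm m | 1+m≡ᵇm m = X<Y

    F-steps : ∀ u → suc u < k → value π (F u) < value π (F (suc u))
    F-steps u 1+u<k with below-at-next 1+u<k
    ... | below 1+u<m rewrite <ᵇ-true (<-trans (n<1+n u) 1+u<m) | <ᵇ-true 1+u<m =
      proj₂ (step asc u 1+u<m)
    ... | at   rewrite <ᵇ-true (n<1+n m₁) | <ᵇ-irrefl m | ≡ᵇ-refl m = c<ᵥY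
    ... | next rewrite <ᵇ-irrefl m | ≡ᵇ-refl m | 1+m<ᵇm m | 1+m≡ᵇm m = Y<ᵥX

  r-occurrence : ∀ {X Y c} → Ascending π m c → X F.< Y → Y F.< c 0 →
                 value π Y < value π X → value π X < value π (c 0) → Contains π (r k)
  r-occurrence {X} {Y} {c} asc X<Y Y<c Y<ᵥX X<ᵥc =
    contains-by-rank π k S E F (r-range m) E≡F∘S E-steps F-steps
    where
    S : ℕ → ℕ
    S x = if x ≡ᵇ 0 then 1 else (if x ≡ᵇ 1 then 0 else x)
    E F : ℕ → Fin n
    E 0 = X
    E 1 = Y
    E (suc (suc x)) = c x
    F 0 = Y
    F 1 = X
    F (suc (suc u)) = c u

    E≡F∘S : ∀ x → x < k → E x ≡ F (S x)
    E≡F∘S 0 _ = refl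
    E≡F∘S 1 _ = refl
    E≡F∘S (suc (suc x)) _ = refl

    E-steps : ∀ x → suc x < k → E x F.< E (suc x)
    E-steps 0 _ = X<Y
    E-steps 1 _ = Y<c
    E-steps (suc (suc x)) 3+x<k = proj₁ (step asc x (s≤s⁻¹ (s≤s⁻¹ 3+x<k)))

    F-steps : ∀ u → suc u < k → value π (F u) < value π (F (suc u))
    F-steps 0 _ = Y<ᵥX
    F-steps 1 _ = X<ᵥc
    F-steps (suc (suc u)) 3+u<k = proj₂ (step asc u (s≤s⁻¹ (s≤s⁻¹ 3+u<k)))

  s-occurrence : ∀ {c Y} → Ascending π (suc m) c → c m F.< Y → value π Y < value π (c 0) →
                 Contains π (s k)
  s-occurrence {c} {Y} asc c<Y Y<ᵥc = contains-by-rank π k S E F (s-range m) E≡F∘S E-steps F-steps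
    where
    S : ℕ → ℕ
    S x = if x ≡ᵇ suc m then 0 else suc x
    E F : ℕ → Fin n
    E x = if x ≡ᵇ suc m then Y else c x
    F 0 = Y
    F (suc u) = c u

    E≡F∘S : ∀ x → x < k → E x ≡ F (S x)
    E≡F∘S x x<k with below-or-last x<k
    ... | inj₁ x<1+m rewrite ≡ᵇ-false (<⇒≢ x<1+m) = refl
    ... | inj₂ refl  rewrite ≡ᵇ-refl (suc m) = refl

    E-steps : ∀ x → suc x < k → E x F.< E (suc x)
    E-steps x 1+x<k with below-or-last (s≤s⁻¹ 1+x<k)
    ... | inj₁ x<m rewrite ≡ᵇ-false (<⇒≢ (m<n⇒m<1+n x<m)) | ≡ᵇ-false (<⇒≢ x<m) =
      proj₁ (step asc x (s≤s x<m))
    ... | inj₂ refl rewrite ≡ᵇ-false (<⇒≢ (n<1+n m)) | ≡ᵇ-refl m = c<Y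

    F-steps : ∀ u → suc u < k → value π (F u) < value π (F (suc u))
    F-steps 0 _ = Y<ᵥc
    F-steps (suc u) 2+u<k = proj₂ (step asc u (s≤s⁻¹ 2+u<k))

  qᶜ-occurrence : ∀ {X c} → Ascending π (suc m) c → X F.< c 0 → value π (c m) < value π X →
                  Contains π (comp (q k))
  qᶜ-occurrence {X} {c} asc X<c c<ᵥX = contains-by-rank π k S E F (comp-range (q k)) E≡F∘S E-steps F-steps
    where
    S : ℕ → ℕ
    S x = suc m ∸ (if x ≡ᵇ 0 then 0 else k ∸ x)
    E F : ℕ → Fin n
    E 0 = X
    E (suc x) = c x
    F u = if u ≡ᵇ suc m then X else c u

    E≡F∘S : ∀ x → x < k → E x ≡ F (S x)
    E≡F∘S 0 _ rewrite ≡ᵇ-refl (suc m) = refl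
    E≡F∘S (suc x) 1+x<k
      rewrite m∸[m∸n]≡n (<⇒≤ (s≤s⁻¹ 1+x<k)) | ≡ᵇ-false (<⇒≢ (s≤s⁻¹ 1+x<k)) = refl

    E-steps : ∀ x → suc x < k → E x F.< E (suc x)
    E-steps 0 _ = X<c
    E-steps (suc x) 2+x<k = proj₁ (step asc x (s≤s⁻¹ 2+x<k))

    F-steps : ∀ u → suc u < k → value π (F u) < value π (F (suc u))
    F-steps u 1+u<k with below-or-last (s≤s⁻¹ 1+u<k)
    ... | inj₁ u<m rewrite ≡ᵇ-false (<⇒≢ (m<n⇒m<1+n u<m)) | ≡ᵇ-false (<⇒≢ u<m) =
      proj₂ (step asc u (s≤s u<m))
    ... | inj₂ refl rewrite ≡ᵇ-false (<⇒≢ (n<1+n m)) | ≡ᵇ-refl m = c<ᵥX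

module _ {n} (π : Perm n) (m₁ : ℕ) where
  private
    m : ℕ
    m = suc m₁
    k : ℕ
    k = suc (suc m)
  open Occurrences (complement π) m₁

  q-occurrence : ∀ {Z d} → Descending π (suc m) d → Z F.< d 0 → value π Z < value π (d m) →
                 Contains π (q k)
  q-occurrence desc Z<d Z<ᵥd = complement-contains-comp⇒contains π (q-range m)
    (qᶜ-occurrence (descending⇒ascending-complement π desc) Z<d (opposite-< Z<ᵥd))

  sᶜ-occurrence : ∀ {d Z} → Descending π (suc m) d → d m F.< Z → value π (d 0) < value π Z →
                  Contains π (comp (s k))
  sᶜ-occurrence desc d<Z d<ᵥZ = complement-contains⇒contains-comp π (s-range m)
    (s-occurrence (descending⇒ascending-complement π desc) d<Z (opposite-< d<ᵥZ))

-- Erdős–Szekeres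

maximal-witness : ∀ {n} (P : Fin n → Set) → (∀ j → Dec (P j)) → (h : Fin n → ℕ) →
                  (∀ j → ¬ P j) ⊎ ∃ λ j → P j × (∀ j′ → P j′ → h j′ ≤ h j)
maximal-witness {zero}  P P? h = inj₁ λ ()
maximal-witness {suc n} P P? h with maximal-witness (P ∘ F.suc) (P? ∘ F.suc) (h ∘ F.suc) | P? F.zero
... | inj₁ none | no ¬P0 = inj₁ λ { F.zero → ¬P0 ; (F.suc j) → none j }
... | inj₁ none | yes P0 = inj₂ (F.zero , P0 , λ { F.zero _ → ≤-refl ; (F.suc j) Pj → ⊥-elim (none j Pj) })
... | inj₂ (j , Pj , max) | no ¬P0 =
  inj₂ (F.suc j , Pj , λ { F.zero P0 → ⊥-elim (¬P0 P0) ; (F.suc j′) Pj′ → max j′ Pj′ })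
... | inj₂ (j , Pj , max) | yes P0 with h F.zero ≤? h (F.suc j)
...   | yes h0≤hj = inj₂ (F.suc j , Pj , λ { F.zero _ → h0≤hj ; (F.suc j′) Pj′ → max j′ Pj′ })
...   | no h0≰hj  = inj₂ (F.zero , P0 , λ { F.zero _ → ≤-refl
                                          ; (F.suc j′) Pj′ → ≤-trans (max j′ Pj′) (<⇒≤ (≰⇒> h0≰hj)) })

module Labellings {n} (R : Fin n → Fin n → Set) (R? : ∀ i j → Dec (R i j)) where

  EndsAt : ℕ → Fin n → Set
  EndsAt ℓ i = ∃ λ c → Chain R (suc ℓ) c × c ℓ ≡ i

  extend-chain : ∀ {ℓ j i} → EndsAt ℓ j → j F.< i → R j i → EndsAt (suc ℓ) i
  extend-chain {ℓ} {j} {i} (c , ch , cℓ≡j) j<i Rji = c′ , chain steps′ , c′-ends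
    where
    c′ : ℕ → Fin n
    c′ x = if x ≡ᵇ suc ℓ then i else c x

    c′-ends : c′ (suc ℓ) ≡ i
    c′-ends rewrite ≡ᵇ-refl ℓ = refl

    steps′ : ∀ x → suc x < suc (suc ℓ) → c′ x F.< c′ (suc x) × R (c′ x) (c′ (suc x))
    steps′ x 1+x<2+ℓ with below-or-last (s≤s⁻¹ 1+x<2+ℓ)
    ... | inj₁ x<ℓ rewrite ≡ᵇ-false (<⇒≢ (m<n⇒m<1+n x<ℓ)) | ≡ᵇ-false (<⇒≢ x<ℓ) = step ch x (s≤s x<ℓ)
    ... | inj₂ refl rewrite ≡ᵇ-false (<⇒≢ (n<1+n ℓ)) | ≡ᵇ-refl ℓ | cℓ≡j = j<i , Rji

  singleton : ∀ i → EndsAt 0 i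
  singleton i = (λ _ → i) , chain (λ { _ (s≤s ()) }) , refl

  long-chain : ∀ {a ℓ i} → a ≤ ℓ → EndsAt ℓ i → ∃ (Chain R (suc a))
  long-chain a≤ℓ (c , ch , _) = c , chain-prefix ch (s≤s a≤ℓ)

  record Labelling (a t : ℕ) : Set where
    field
      label            : Fin n → ℕ
      label<a          : ∀ i → toℕ i < t → label i < a
      ends-at          : ∀ i → toℕ i < t → EndsAt (label i) i
      label-increasing : ∀ {j i} → j F.< i → toℕ i < t → R j i → label j < label i

  empty : ∀ {a} → Labelling a 0
  empty = record { label = λ _ → 0 ; label<a = λ _ () ; ends-at = λ _ () ; label-increasing = λ _ () }

  module _ {a t} (t<n : t < n) (L : Labelling a t) where
    open Labelling L
    private
      i : Fin n
      i = fromℕ< t<n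

      earlier-or-new : ∀ x → toℕ x < suc t → toℕ x < t ⊎ x ≡ i
      earlier-or-new x x<1+t with below-or-last x<1+t
      ... | inj₁ x<t = inj₁ x<t
      ... | inj₂ x≡t = inj₂ (FP.toℕ-injective (trans x≡t (sym (FP.toℕ-fromℕ< t<n))))

      earlier⇒<new : ∀ {x : Fin n} → toℕ x < t → x F.< i
      earlier⇒<new {x} = subst (toℕ x <_) (sym (FP.toℕ-fromℕ< t<n))

      earlier≢new : ∀ {x : Fin n} → toℕ x < t → x ≢ i
      earlier≢new x<t refl = <-irrefl refl (earlier⇒<new x<t)

      <new⇒earlier : ∀ {j : Fin n} → j F.< i → toℕ j < t
      <new⇒earlier {j} = subst (toℕ j <_) (FP.toℕ-fromℕ< t<n)

    next-label : ∃ λ ℓ → EndsAt ℓ i × (∀ j → toℕ j < t → R j i → label j < ℓ)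
    next-label with maximal-witness (λ j → toℕ j < t × R j i) (λ j → (toℕ j <? t) ×-dec R? j i) label
    ... | inj₁ none = 0 , singleton i , λ j j<t Rji → ⊥-elim (none j (j<t , Rji))
    ... | inj₂ (j , (j<t , Rji) , max) =
      suc (label j) , extend-chain (ends-at j j<t) (earlier⇒<new j<t) Rji ,
      λ j′ j′<t Rj′i → s≤s (max j′ (j′<t , Rj′i))

    insert : ∀ {ℓ} → ℓ < a → EndsAt ℓ i → (∀ j → toℕ j < t → R j i → label j < ℓ) →
             Labelling a (suc t)
    insert {ℓ} ℓ<a ends above = record
      { label = label′ ; label<a = label′<a ; ends-at = ends-at′ ; label-increasing = increasing′ }
      where
      label′ : Fin n → ℕ
      label′ = updateAt label i (λ _ → ℓ)

      new : label′ i ≡ ℓ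
      new = updateAt-updates i label

      old : ∀ {x} → toℕ x < t → label′ x ≡ label x
      old {x} x<t = updateAt-minimal x i label (earlier≢new x<t)

      label′<a : ∀ x → toℕ x < suc t → label′ x < a
      label′<a x x<1+t with earlier-or-new x x<1+t
      ... | inj₁ x<t  rewrite old x<t = label<a x x<t
      ... | inj₂ refl rewrite new = ℓ<a

      ends-at′ : ∀ x → toℕ x < suc t → EndsAt (label′ x) x
      ends-at′ x x<1+t with earlier-or-new x x<1+t
      ... | inj₁ x<t  rewrite old x<t = ends-at x x<t
      ... | inj₂ refl rewrite new = ends

      increasing′ : ∀ {j x} → j F.< x → toℕ x < suc t → R j x → label′ j < label′ x
      increasing′ {j} {x} j<x x<1+t Rjx with earlier-or-new x x<1+t
      ... | inj₁ x<t  rewrite old x<t | old {j} (<-trans j<x x<t) = label-increasing j<x x<t Rjx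
      ... | inj₂ refl rewrite new | old {j} (<new⇒earlier j<x) = above j (<new⇒earlier j<x) Rjx

    extend : ∃ (Chain R (suc a)) ⊎ Labelling a (suc t)
    extend with next-label
    ... | ℓ , ends , above with ℓ <? a
    ...   | yes ℓ<a = inj₂ (insert ℓ<a ends above)
    ...   | no  ℓ≮a = inj₁ (long-chain (≮⇒≥ ℓ≮a) ends)

-- Labels grow along R and along S, so distinct positions carry distinct pairs of labels;
-- if all labels stay below a and b respectively, this contradicts a * b < n.
erdős-szekeres : ∀ {n} (R S : Fin n → Fin n → Set) → (∀ i j → Dec (R i j)) → (∀ i j → Dec (S i j)) →
                 (∀ {i j} → i F.< j → R i j ⊎ S i j) →
                 ∀ a b → a * b < n → ∃ (Chain R (suc a)) ⊎ ∃ (Chain S (suc b))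
erdős-szekeres {n} R S R? S? R-or-S a b ab<n with labellings n ≤-refl
  where
  module LR = Labellings R R?
  module LS = Labellings S S?

  labellings : ∀ t → t ≤ n →
               (∃ (Chain R (suc a)) ⊎ ∃ (Chain S (suc b))) ⊎ (LR.Labelling a t × LS.Labelling b t)
  labellings zero _ = inj₂ (LR.empty , LS.empty)
  labellings (suc t) t<n with labellings t (<⇒≤ t<n)
  ... | inj₁ long = inj₁ long
  ... | inj₂ (LRₜ , LSₜ) with LR.extend t<n LRₜ | LS.extend t<n LSₜ
  ...   | inj₁ long | _         = inj₁ (inj₁ long)
  ...   | inj₂ _    | inj₁ long = inj₁ (inj₂ long)
  ...   | inj₂ LR′  | inj₂ LS′  = inj₂ (LR′ , LS′)
... | inj₁ long = long
... | inj₂ (LRₙ , LSₙ) = ⊥-elim contradiction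
  where
  open Labellings.Labelling LRₙ renaming (label to f; label<a to f<a; label-increasing to f-increasing)
  open Labellings.Labelling LSₙ renaming (label to g; label<a to g<b; label-increasing to g-increasing)

  pair : Fin n → Fin (a * b)
  pair i = F.combine (fromℕ< (f<a i (FP.toℕ<n i))) (fromℕ< (g<b i (FP.toℕ<n i)))

  contradiction : ⊥
  contradiction with FP.pigeonhole ab<n pair
  ... | i , j , i<j , same with FP.combine-injective {m = a} {n = b} _ _ _ _ same
  ...   | f-same , g-same with R-or-S i<j
  ...     | inj₁ Rij = <-irrefl (FP.fromℕ<-injective _ _ _ _ f-same) (f-increasing i<j (FP.toℕ<n j) Rij)
  ...     | inj₂ Sij = <-irrefl (FP.fromℕ<-injective _ _ _ _ g-same) (g-increasing i<j (FP.toℕ<n j) Sij)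

ascending-or-descending : ∀ {n} (π : Perm n) a b → a * b < n →
                          ∃ (Ascending π (suc a)) ⊎ ∃ (Descending π (suc b))
ascending-or-descending π = erdős-szekeres _ _
  (λ i j → value π i <? value π j) (λ i j → value π j <? value π i) (value-cmp π)

-- Monotone permutations

Inversion : ∀ {n} → Perm n → Set
Inversion π = ∃₂ λ i j → i F.< j × value π j < value π i

inversion-or-increasing : ∀ {n} (π : Perm n) → Inversion π ⊎ (∀ {i j} → i F.< j → value π i < value π j)
inversion-or-increasing π
  with FP.any? (λ i → FP.any? (λ j → (toℕ i <? toℕ j) ×-dec (value π j <? value π i)))
... | yes (i , j , inversion) = inj₁ (i , j , inversion)
... | no none = inj₂ λ {i} {j} i<j →
  fromInj₁ (λ j<ᵥi → ⊥-elim (none (i , j , i<j , j<ᵥi))) (value-cmp π i<j)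

increasing⇒toℕ≤ : ∀ {n} (f : Fin n → ℕ) → (∀ {i j} → i F.< j → f i < f j) → ∀ i → toℕ i ≤ f i
increasing⇒toℕ≤ f increasing F.zero    = z≤n
increasing⇒toℕ≤ f increasing (F.suc i) =
  ≤-trans (s≤s (increasing⇒toℕ≤ (f ∘ F.inject₁) increasing′ i)) (increasing (FP.≤̄⇒inject₁< ≤-refl))
  where
  increasing′ : ∀ {i j} → i F.< j → f (F.inject₁ i) < f (F.inject₁ j)
  increasing′ {i} {j} i<j = increasing (subst₂ _<_ (sym (FP.toℕ-inject₁ i)) (sym (FP.toℕ-inject₁ j)) i<j)

-- Conjugating by i ↦ n-1-i turns the lower bound i ≤ π i into the upper bound.
increasing⇒identity : ∀ {n} (π : Perm n) → (∀ {i j} → i F.< j → value π i < value π j) → IsId π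
increasing⇒identity π increasing i =
  FP.toℕ-injective (≤-antisym (≮⇒≥ λ i<πi → <⇒≱ (opposite-< i<πi) (upper i))
                              (increasing⇒toℕ≤ (value π) increasing i))
  where
  conjugate : Fin _ → ℕ
  conjugate x = toℕ (opposite (proj₁ π (opposite x)))

  upper : ∀ x → toℕ (opposite x) ≤ toℕ (opposite (proj₁ π x))
  upper x = subst (λ y → toℕ (opposite x) ≤ toℕ (opposite (proj₁ π y))) (FP.opposite-involutive x)
    (increasing⇒toℕ≤ conjugate (λ i<j → opposite-< (increasing (opposite-< i<j))) (opposite x))

complement-identity⇒reverse : ∀ {n} (π : Perm n) → IsId (complement π) → IsRev π
complement-identity⇒reverse π idᶜ i = trans (sym (FP.opposite-involutive (proj₁ π i))) (cong opposite (idᶜ i))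

inversions-or-monotone : ∀ {n} (π : Perm n) → Inversion π × Inversion (complement π) ⊎ (IsId π ⊎ IsRev π)
inversions-or-monotone π with inversion-or-increasing π | inversion-or-increasing (complement π)
... | inj₂ increasing | _ = inj₂ (inj₁ (increasing⇒identity π increasing))
... | inj₁ _ | inj₂ increasingᶜ =
  inj₂ (inj₂ (complement-identity⇒reverse π (increasing⇒identity (complement π) increasingᶜ)))
... | inj₁ inversion | inj₁ inversionᶜ = inj₁ (inversion , inversionᶜ)

Ascent Descent Unsorted : ∀ {k} → Pattern k → Set
Ascent σ   = ∃₂ λ a b → a F.< b × σ a < σ b
Descent σ  = ∃₂ λ a b → a F.< b × σ b < σ a
Unsorted σ = Ascent σ × Descent σ

comp-unsorted : ∀ {k} {σ : Pattern k} → (∀ j → σ j < k) → Unsorted σ → Unsorted (comp σ)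
comp-unsorted range ((a , b , a<b , σa<σb) , (c , d , c<d , σd<σc)) =
  (c , d , c<d , from (comp-reverses range c d) σd<σc) , (a , b , a<b , from (comp-reverses range b a) σa<σb)

monotone-avoids-unsorted : ∀ {n k} (π : Perm n) {σ : Pattern k} → IsId π ⊎ IsRev π → Unsorted σ →
                           ¬ Contains π σ
monotone-avoids-unsorted π (inj₁ isId) (_ , (a , b , a<b , σb<σa)) (e , e-increasing , order) =
  <-asym (e-increasing a b a<b) (subst₂ F._<_ (isId (e b)) (isId (e a)) (to (order b a) σb<σa))
monotone-avoids-unsorted π (inj₂ isRev) ((a , b , a<b , σa<σb) , _) (e , e-increasing , order) =
  <-asym (e-increasing a b a<b)
         (opposite-<⁻¹ (subst₂ F._<_ (isRev (e a)) (isRev (e b)) (to (order a b) σa<σb)))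

module LastTwo (m : ℕ) where
  private
    k : ℕ
    k = suc (suc m)

  penultimate last : Fin k
  penultimate = F.inject₁ (F.fromℕ m)
  last        = F.fromℕ (suc m)

  toℕ-penultimate : toℕ penultimate ≡ m
  toℕ-penultimate = trans (FP.toℕ-inject₁ (F.fromℕ m)) (FP.toℕ-fromℕ m)

  toℕ-last : toℕ last ≡ suc m
  toℕ-last = FP.toℕ-fromℕ (suc m)

  penultimate<last : penultimate F.< last
  penultimate<last = subst₂ _<_ (sym toℕ-penultimate) (sym toℕ-last) (n<1+n m)

  p-penultimate : p k penultimate ≡ suc m
  p-penultimate rewrite toℕ-penultimate | <ᵇ-irrefl m | ≡ᵇ-refl m = refl

  p-last : p k last ≡ m
  p-last rewrite FP.toℕ-fromℕ m | 1+m<ᵇm m | 1+m≡ᵇm m = refl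

  s-penultimate : s k penultimate ≡ suc m
  s-penultimate rewrite toℕ-penultimate | ≡ᵇ-false (<⇒≢ (n<1+n m)) = refl

  s-last : s k last ≡ 0
  s-last rewrite FP.toℕ-fromℕ m | ≡ᵇ-refl (suc m) = refl

module _ (m₁ : ℕ) where
  private
    m : ℕ
    m = suc m₁
    k : ℕ
    k = suc (suc m)
  open LastTwo m

  p-unsorted : Unsorted (p k)
  p-unsorted = (F.zero , last , s≤s z≤n , subst (0 <_) (sym p-last) (s≤s z≤n))
             , (penultimate , last , penultimate<last , subst₂ _<_ (sym p-last) (sym p-penultimate) (n<1+n m))

  q-unsorted : Unsorted (q k)
  q-unsorted = (# 0 , # 1 , s≤s z≤n , s≤s z≤n) , (# 1 , # 2 , s≤s (s≤s z≤n) , n<1+n m)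

  r-unsorted : Unsorted (r k)
  r-unsorted = (# 1 , # 2 , s≤s (s≤s z≤n) , s≤s z≤n) , (# 0 , # 1 , s≤s z≤n , s≤s z≤n)

  s-unsorted : Unsorted (s k)
  s-unsorted = (# 0 , # 1 , s≤s z≤n , s≤s (s≤s z≤n))
             , (penultimate , last , penultimate<last , subst₂ _<_ (sym s-last) (sym s-penultimate) (s≤s z≤n))

monotone-avoids-B : ∀ {n} m₁ (π : Perm n) → IsId π ⊎ IsRev π → Avoids π (B (3 + m₁))
monotone-avoids-B m₁ π monotone =
    avoid (p-unsorted m₁) ∷ avoid (q-unsorted m₁) ∷ avoid (r-unsorted m₁) ∷ avoid (s-unsorted m₁)
  ∷ avoid (comp-unsorted (p-range (suc m₁)) (p-unsorted m₁))
  ∷ avoid (comp-unsorted (q-range (suc m₁)) (q-unsorted m₁))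
  ∷ avoid (comp-unsorted (r-range (suc m₁)) (r-unsorted m₁))
  ∷ avoid (comp-unsorted (s-range (suc m₁)) (s-unsorted m₁))
  ∷ []
  where
  avoid : ∀ {σ : Pattern (3 + m₁)} → Unsorted σ → ¬ Contains π σ
  avoid = monotone-avoids-unsorted π monotone

-- Avoiders of B_k

module Avoiding {n} (π : Perm n) (m₁ : ℕ)
  (¬p : ¬ Contains π (p (3 + m₁))) (¬q : ¬ Contains π (q (3 + m₁)))
  (¬r : ¬ Contains π (r (3 + m₁))) (¬s : ¬ Contains π (s (3 + m₁)))
  (¬qᶜ : ¬ Contains π (comp (q (3 + m₁)))) (¬sᶜ : ¬ Contains π (comp (s (3 + m₁))))
  where
  open Occurrences π m₁
  private
    m : ℕ
    m = suc m₁

    _<ᵥ_ : Fin n → Fin n → Set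
    i <ᵥ j = value π i < value π j

  -- Avoiding s and qᶜ keeps the entries right of β above α and those left of α below β;
  -- an inversion is then an occurrence of p (right of α) or of r (left of β).
  module _ {u} (asc : Ascending π (m + (m + m₁)) u) where
    private
      α β : Fin n
      α = u m₁
      β = u (m + m₁)

      m₁<m+m₁ : m₁ < m + m₁
      m₁<m+m₁ = m<n+m m₁ (s≤s z≤n)

      m+m₁<m+[m+m₁] : m + m₁ < m + (m + m₁)
      m+m₁<m+[m+m₁] = m<n+m (m + m₁) (s≤s z≤n)

      α<β : α F.< β
      α<β = chain-positions asc m₁<m+m₁ m+m₁<m+[m+m₁]

      α<ᵥβ : α <ᵥ β
      α<ᵥβ = ascending-values π asc m₁<m+m₁ m+m₁<m+[m+m₁]

      up-to-α : Ascending π m u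
      up-to-α = chain-prefix asc (m≤m+n m (m + m₁))

      α-to-β : Ascending π (suc m) (λ x → u (x + m₁))
      α-to-β = chain-suffix m₁ (chain-prefix asc (s≤s (m≤n+m (m + m₁) m₁)))

      from-β : Ascending π m (λ x → u (x + (m + m₁)))
      from-β = chain-suffix (m + m₁) asc

      after-β⇒above-α : ∀ {Z} → β F.< Z → α <ᵥ Z
      after-β⇒above-α β<Z =
        fromInj₁ (⊥-elim ∘ ¬s ∘ s-occurrence α-to-β β<Z) (value-cmp π (FP.<-trans α<β β<Z))

      before-α⇒below-β : ∀ {Z} → Z F.< α → Z <ᵥ β
      before-α⇒below-β Z<α =
        fromInj₁ (⊥-elim ∘ ¬qᶜ ∘ qᶜ-occurrence α-to-β Z<α) (value-cmp π (FP.<-trans Z<α α<β))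

      below-α⇒before-β : ∀ {Z} → Z <ᵥ α → Z F.< β
      below-α⇒before-β Z<ᵥα =
        fromInj₁ (⊥-elim ∘ <-asym Z<ᵥα ∘ after-β⇒above-α) (position-cmp π (<-trans Z<ᵥα α<ᵥβ))

      no-inversion-below-β : ∀ {X Y} → X F.< Y → Y F.< β → Y <ᵥ X → X <ᵥ β → ⊥
      no-inversion-below-β X<Y Y<β Y<ᵥX X<ᵥβ = ¬r (r-occurrence from-β X<Y Y<β Y<ᵥX X<ᵥβ)

      no-inversion-from-α : ∀ {Y} → α F.< Y → Y <ᵥ α → ⊥
      no-inversion-from-α α<Y Y<ᵥα = no-inversion-below-β α<Y (below-α⇒before-β Y<ᵥα) Y<ᵥα α<ᵥβ

      no-inversion-before-α : ∀ {X Y} → X F.< Y → Y <ᵥ X → X F.< α → ⊥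
      no-inversion-before-α {X} X<Y Y<ᵥX X<α = [ below-α , above-α ] (value-cmp π X<α)
        where
        X<ᵥβ : X <ᵥ β
        X<ᵥβ = before-α⇒below-β X<α

        below-α : X <ᵥ α → ⊥
        below-α X<ᵥα = no-inversion-below-β X<Y (below-α⇒before-β (<-trans Y<ᵥX X<ᵥα)) Y<ᵥX X<ᵥβ

        above-α : α <ᵥ X → ⊥
        above-α α<ᵥX = no-inversion-below-β X<α α<β α<ᵥX X<ᵥβ

      no-inversion-after-α : ∀ {X Y} → X F.< Y → Y <ᵥ X → α F.< X → ⊥
      no-inversion-after-α {Y = Y} X<Y Y<ᵥX α<X =
        [ (λ α<ᵥY → ¬p (p-occurrence up-to-α α<X X<Y α<ᵥY Y<ᵥX)) , no-inversion-from-α α<Y ] (value-cmp π α<Y)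
        where
        α<Y : α F.< Y
        α<Y = FP.<-trans α<X X<Y

    no-inversion-beside-long-ascent : Inversion π → ⊥
    no-inversion-beside-long-ascent (X , Y , X<Y , Y<ᵥX) with <-cmp (toℕ X) (toℕ α)
    ... | tri< X<α _ _ = no-inversion-before-α X<Y Y<ᵥX X<α
    ... | tri> _ _ α<X = no-inversion-after-α X<Y Y<ᵥX α<X
    ... | tri≈ _ X≡α _ with FP.toℕ-injective X≡α
    ...   | refl = no-inversion-from-α X<Y Y<ᵥX

  module _ {u w} (1<m : 1 < m) (asc : Ascending π (suc (m + m₁)) u) (desc : Descending π (suc m) w) where
    private
      X W Y α α′ β : Fin n
      X  = w 0
      W  = w 1
      Y  = w m
      α  = u m₁
      α′ = u m
      β  = u (m + m₁)

      0<1 : 0 < 1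
      0<1 = s≤s z≤n

      1<1+m : 1 < suc m
      1<1+m = s≤s (s≤s z≤n)

      m<1+m+m₁ : m < suc (m + m₁)
      m<1+m+m₁ = s≤s (m≤m+n m m₁)

      m<m+m₁ : m < m + m₁
      m<m+m₁ = m<m+n m (s≤s⁻¹ 1<m)

      X<W : X F.< W
      X<W = chain-positions desc 0<1 1<1+m

      W<Y : W F.< Y
      W<Y = chain-positions desc 1<m (n<1+n m)

      X<Y : X F.< Y
      X<Y = FP.<-trans X<W W<Y

      W<ᵥX : W <ᵥ X
      W<ᵥX = descending-values π desc 0<1 1<1+m

      Y<ᵥW : Y <ᵥ W
      Y<ᵥW = descending-values π desc 1<m (n<1+n m)

      Y<ᵥX : Y <ᵥ X
      Y<ᵥX = <-trans Y<ᵥW W<ᵥX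

      u0<α′ : u 0 F.< α′
      u0<α′ = chain-positions asc (s≤s z≤n) m<1+m+m₁

      α<α′ : α F.< α′
      α<α′ = chain-positions asc (n<1+n m₁) m<1+m+m₁

      α′<β : α′ F.< β
      α′<β = chain-positions asc m<m+m₁ (n<1+n (m + m₁))

      α<β : α F.< β
      α<β = FP.<-trans α<α′ α′<β

      u0<ᵥα′ : u 0 <ᵥ α′
      u0<ᵥα′ = ascending-values π asc (s≤s z≤n) m<1+m+m₁

      α<ᵥα′ : α <ᵥ α′
      α<ᵥα′ = ascending-values π asc (n<1+n m₁) m<1+m+m₁

      α′<ᵥβ : α′ <ᵥ β
      α′<ᵥβ = ascending-values π asc m<m+m₁ (n<1+n (m + m₁))

      α<ᵥβ : α <ᵥ β
      α<ᵥβ = <-trans α<ᵥα′ α′<ᵥβ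

      up-to-α : Ascending π m u
      up-to-α = chain-prefix asc (<⇒≤ m<1+m+m₁)

      up-to-α′ : Ascending π (suc m) u
      up-to-α′ = chain-prefix asc m<1+m+m₁

      α-to-β : Ascending π (suc m) (λ x → u (x + m₁))
      α-to-β = chain-suffix m₁ asc

      from-α′ : Ascending π m (λ x → u (x + m))
      from-α′ = chain-suffix m (chain-prefix asc (≤-reflexive (cong suc (+-suc m₁ m₁))))

      no-entry-after-Y-above-X : ∀ {Z} → Y F.< Z → X <ᵥ Z → ⊥
      no-entry-after-Y-above-X Y<Z X<ᵥZ = ¬sᶜ (sᶜ-occurrence π m₁ desc Y<Z X<ᵥZ)

      X-before-u0 : X F.< u 0 → ⊥
      X-before-u0 X<u0 = [ α-before-W , W-before-α ] (position-cmp π (<-trans α<ᵥY Y<ᵥW))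
        where
        X<ᵥα′ : X <ᵥ α′
        X<ᵥα′ = fromInj₁ (⊥-elim ∘ ¬qᶜ ∘ qᶜ-occurrence up-to-α′ X<u0)
                         (value-cmp π (FP.<-trans X<u0 u0<α′))

        β<Y : β F.< Y
        β<Y = fromInj₂ (λ Y<β → ⊥-elim (no-entry-after-Y-above-X Y<β (<-trans X<ᵥα′ α′<ᵥβ)))
                       (position-cmp π (<-trans (<-trans Y<ᵥX X<ᵥα′) α′<ᵥβ))

        α<ᵥY : α <ᵥ Y
        α<ᵥY = fromInj₁ (⊥-elim ∘ ¬s ∘ s-occurrence α-to-β β<Y) (value-cmp π (FP.<-trans α<β β<Y))

        α-before-W : α F.< W → ⊥
        α-before-W α<W = ¬p (p-occurrence up-to-α α<W W<Y α<ᵥY Y<ᵥW)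

        W-before-α : W F.< α → ⊥
        W-before-α W<α = ¬r (r-occurrence from-α′ X<W (FP.<-trans W<α α<α′) W<ᵥX X<ᵥα′)

      Y-below-u0 : Y <ᵥ u 0 → ⊥
      Y-below-u0 Y<ᵥu0 = [ α-below-W , W-below-α ] (value-cmp π (FP.<-trans α<X X<W))
        where
        Y<α′ : Y F.< α′
        Y<α′ = fromInj₁ (⊥-elim ∘ ¬s ∘ flip (s-occurrence up-to-α′) Y<ᵥu0)
                        (position-cmp π (<-trans Y<ᵥu0 u0<ᵥα′))

        β<ᵥX : β <ᵥ X
        β<ᵥX = fromInj₂ (⊥-elim ∘ no-entry-after-Y-above-X (FP.<-trans Y<α′ α′<β))
                        (value-cmp π (FP.<-trans X<Y (FP.<-trans Y<α′ α′<β)))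

        α<X : α F.< X
        α<X = fromInj₁ (⊥-elim ∘ ¬qᶜ ∘ flip (qᶜ-occurrence α-to-β) β<ᵥX)
                       (position-cmp π (<-trans α<ᵥβ β<ᵥX))

        α-below-W : α <ᵥ W → ⊥
        α-below-W α<ᵥW = ¬p (p-occurrence up-to-α α<X X<W α<ᵥW W<ᵥX)

        W-below-α : W <ᵥ α → ⊥
        W-below-α W<ᵥα = ¬r (r-occurrence from-α′ W<Y Y<α′ Y<ᵥW (<-trans W<ᵥα α<ᵥα′))

    no-ascent-and-descent : ⊥
    no-ascent-and-descent with <-cmp (toℕ X) (toℕ (u 0))
    ... | tri< X<u0 _ _ = X-before-u0 X<u0
    ... | tri≈ _ X≡u0 _ = Y-below-u0 (subst (Y <ᵥ_) (FP.toℕ-injective X≡u0) Y<ᵥX)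
    ... | tri> _ _ u0<X = Y-below-u0
      (fromInj₂ (⊥-elim ∘ ¬q ∘ q-occurrence π m₁ desc u0<X) (value-cmp π (FP.<-trans u0<X X<Y)))

[3m₁+1][m₁+1]≤[2m₁+1]² : ∀ m₁ → (m₁ + (suc m₁ + m₁)) * suc m₁ ≤ (suc m₁ + m₁) * (suc m₁ + m₁)
[3m₁+1][m₁+1]≤[2m₁+1]² m₁ = ≤-trans (m≤m+n _ (m₁ * m₁)) (≤-reflexive ([3m₁+1][m₁+1]+m₁²≡[2m₁+1]² m₁))
  where
  [3m₁+1][m₁+1]+m₁²≡[2m₁+1]² : ∀ m₁ → (m₁ + (suc m₁ + m₁)) * suc m₁ + m₁ * m₁ ≡ (suc m₁ + m₁) * (suc m₁ + m₁)
  [3m₁+1][m₁+1]+m₁²≡[2m₁+1]² = solve-∀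

[2k∸5]²+1≡[2m₁+1]²+1 : ∀ m₁ → (2 * (3 + m₁) ∸ 5) ^ 2 + 1 ≡ suc ((suc m₁ + m₁) * (suc m₁ + m₁))
[2k∸5]²+1≡[2m₁+1]²+1 m₁ = trans (cong (λ x → (x ∸ 5) ^ 2 + 1) (double m₁)) (square (suc m₁ + m₁))
  where
  double : ∀ m₁ → 2 * (3 + m₁) ≡ 5 + (suc m₁ + m₁)
  double = solve-∀

  square : ∀ x → x ^ 2 + 1 ≡ suc (x * x)
  square x = trans (cong (λ y → x * y + 1) (*-identityʳ x)) (+-comm (x * x) 1)

no-inversion-with-ascent : ∀ {n} m₁ (π : Perm n) → 1 ≤ m₁ → (suc m₁ + m₁) * (suc m₁ + m₁) < n →
                           Avoids π (B (3 + m₁)) → Inversion π →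
                           ∀ {u} → Ascending π (suc (suc m₁ + m₁)) u → ⊥
no-inversion-with-ascent m₁ π 1≤m₁ bound (¬p ∷ ¬q ∷ ¬r ∷ ¬s ∷ _ ∷ ¬qᶜ ∷ _ ∷ ¬sᶜ ∷ []) inversion asc =
  [ (λ (_ , long) → no-inversion-beside-long-ascent long inversion)
  , (λ (_ , desc) → no-ascent-and-descent (s≤s 1≤m₁) asc desc) ]
  (ascending-or-descending π (m₁ + (suc m₁ + m₁)) (suc m₁)
                           (≤-<-trans ([3m₁+1][m₁+1]≤[2m₁+1]² m₁) bound))
  where open Avoiding π m₁ ¬p ¬q ¬r ¬s ¬qᶜ ¬sᶜ

avoids-B⇒monotone : ∀ {n} m₁ (π : Perm n) → 1 ≤ m₁ → (suc m₁ + m₁) * (suc m₁ + m₁) < n →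
                    Avoids π (B (3 + m₁)) → IsId π ⊎ IsRev π
avoids-B⇒monotone m₁ π 1≤m₁ bound avoids with inversions-or-monotone π
... | inj₂ monotone = monotone
... | inj₁ (inversion , inversionᶜ) = ⊥-elim ([ ascent-in-π , ascent-in-complement ] long-chain)
  where
  long-chain : ∃ (Ascending π (suc (suc m₁ + m₁))) ⊎ ∃ (Descending π (suc (suc m₁ + m₁)))
  long-chain = ascending-or-descending π (suc m₁ + m₁) (suc m₁ + m₁) bound

  ascent-in-π : ∃ (Ascending π (suc (suc m₁ + m₁))) → ⊥
  ascent-in-π (_ , asc) = no-inversion-with-ascent m₁ π 1≤m₁ bound avoids inversion asc

  ascent-in-complement : ∃ (Descending π (suc (suc m₁ + m₁))) → ⊥
  ascent-in-complement (_ , desc) = no-inversion-with-ascent m₁ (complement π) 1≤m₁ bound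
    (avoids-B-complement (suc m₁) π avoids) inversionᶜ (descending⇒ascending-complement π desc)

corollary7p2 : (k n : ℕ) → 4 ≤ k → (2 * k ∸ 5) ^ 2 + 1 ≤ n →
    (π : Perm n) → Avoids π (B k) ⇔ (IsId π ⊎ IsRev π)
corollary7p2 (suc (suc (suc m₁))) n (s≤s (s≤s (s≤s 1≤m₁))) bound π =
  mk⇔ (avoids-B⇒monotone m₁ π 1≤m₁ square-bound) (monotone-avoids-B m₁ π)
  where
  square-bound : (suc m₁ + m₁) * (suc m₁ + m₁) < n
  square-bound = subst (_≤ n) ([2k∸5]²+1≡[2m₁+1]²+1 m₁) bound
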